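{- Let $k$ be a positive integer and consider the $\mathcal{L}\mathcal{R}$-ending partisan subtraction game with subtraction set $S = \{2, 4k+1\}$. Let $G$ be the position consisting of a single pile of $n \ge 0$ tokens. Then the equivalence class of $G$ is periodic in $n$ with period $4k+3$, and for $0 \le n < 4k+3$ it is given by: for $\ell = 0, \dots, k-1$, $G \equiv *L$ if $n = 4\ell$, $G \equiv *R$ if $n = 4\ell+1$, $G \equiv \{*L\}$ if $n = 4\ell+2$, $G \equiv \{*R\}$ if $n = 4\ell+3$; moreover $G \equiv *L$ if $n = 4k$, $G \equiv \{*L, \{*R\}\}$ if $n = 4k+1$, and $G \equiv \{*L, *R\}$ if $n = 4k+2$.
   Context: Abstract positions are defined recursively: $*L$ and $*R$ are terminal positions; if $G_1,\dots,G_m$ ($m\ge 1$) are positions, then $\{G_1,\dots,G_m\}$ is a position with options $G_1,\dots,G_m$. Play: Left and Right move alternately, each choosing any option of the current position; when a terminal position is reached, Left wins if it is $*L$ and Right wins if it is $*R$. Disjunctive sum: $*L + *L = *R + *R = *L$, $*L + *R = *R + *L = *R$; if at least one of $G,H$ is non-terminal, $G+H$ has options all $G'+H$ ($G'$ an option of $G$) and all $G+H'$ ($H'$ an option of $H$). Outcome classes: $\mathcal{L}$, $\mathcal{R}$, $\mathcal{N}$, $\mathcal{P}$ (Left wins, Right wins, first player wins, second player wins, respectively); $o(G)$ is the outcome class. Equivalence: $G \equiv H$ iff $o(G+X) = o(H+X)$ for every abstract position $X$. The $\mathcal{L}\mathcal{R}$-ending partisan subtraction game with subtraction set $S$: a move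 consists of choosing a pile and removing $s \in S$ tokens from it (requiring $s \le$ pile size); both players have the same moves; when no move is possible, Left wins if the total number of remaining tokens is even and Right wins if it is odd. A single pile of $n$ tokens is identified with an abstract position recursively: if no move is possible it is $*L$ for $n$ even and $*R$ for $n$ odd; otherwise it is $\{P_{n-s} : s \in S, s \le n\}$, where $P_m$ is the position of a single pile with $m$ tokens. -}

module Defs where

open import Data.Nat using (ℕ; zero; suc; _+_; _*_; _∸_; _≤ᵇ_)
open import Data.Bool using (Bool; true; false; _∨_; _∧_; not; if_then_else_)
open import Relation.Binary.PropositionalEquality using (_≡_)

-- Abstract positions: terminal *L, *R, or a node with a NONEMPTY list of options.
mutual
  data Pos : Set where
    *L   : Pos
    *R   : Pos
    node : Pos → Opts → Pos

  data Opts : Set where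
    []  : Opts
    _∷_ : Pos → Opts → Opts

infixr 5 _∷_

⟪_⟫ : Pos → Pos
⟪ G ⟫ = node G []

⟪_,_⟫ : Pos → Pos → Pos
⟪ G , H ⟫ = node G (H ∷ [])

_++ₒ_ : Opts → Opts → Opts
[] ++ₒ ys = ys
(x ∷ xs) ++ₒ ys = x ∷ (xs ++ₒ ys)

mutual
  _⊕_ : Pos → Pos → Pos
  *L ⊕ *L = *L
  *L ⊕ *R = *R
  *R ⊕ *L = *R
  *R ⊕ *R = *L
  *L ⊕ node h hs = node (*L ⊕ h) (rsum *L hs)
  *R ⊕ node h hs = node (*R ⊕ h) (rsum *R hs)
  node g gs ⊕ H = node (g ⊕ H) (lsum gs H ++ₒ rsumN g gs H)

  lsum : Opts → Pos → Opts
  lsum [] H = []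
  lsum (g ∷ gs) H = (g ⊕ H) ∷ lsum gs H

  rsum : Pos → Opts → Opts
  rsum G [] = []
  rsum G (h ∷ hs) = (G ⊕ h) ∷ rsum G hs

  rsumN : Pos → Opts → Pos → Opts
  rsumN g gs *L = []
  rsumN g gs *R = []
  rsumN g gs (node h hs) = (node g gs ⊕ h) ∷ rsumN' g gs hs

  rsumN' : Pos → Opts → Opts → Opts
  rsumN' g gs [] = []
  rsumN' g gs (h ∷ hs) = (node g gs ⊕ h) ∷ rsumN' g gs hs

infixl 6 _⊕_

-- leftWinsL G : Left wins G when Left moves first.
-- leftWinsR G : Left wins G when Right moves first.
mutual
  leftWinsL : Pos → Bool
  leftWinsL *L = true
  leftWinsL *R = false
  leftWinsL (node g gs) = leftWinsR g ∨ anyR gs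

  anyR : Opts → Bool
  anyR [] = false
  anyR (g ∷ gs) = leftWinsR g ∨ anyR gs

  leftWinsR : Pos → Bool
  leftWinsR *L = true
  leftWinsR *R = false
  leftWinsR (node g gs) = leftWinsL g ∧ allL gs

  allL : Opts → Bool
  allL [] = true
  allL (g ∷ gs) = leftWinsL g ∧ allL gs

data Outcome : Set where
  𝓛 𝓡 𝓝 𝓟 : Outcome

outcome : Pos → Outcome
outcome G with leftWinsL G | leftWinsR G
... | true  | true  = 𝓛
... | false | false = 𝓡
... | true  | false = 𝓝
... | false | true  = 𝓟

_≡ᵍ_ : Pos → Pos → Set
G ≡ᵍ H = ∀ (X : Pos) → outcome (G ⊕ X) ≡ outcome (H ⊕ X)

infix 4 _≡ᵍ_

even? : ℕ → Bool
even? zero = true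
even? (suc zero) = false
even? (suc (suc n)) = even? n

-- Single pile of the LR-ending subtraction game with S = {2, a} (a = 4k+1 ≥ 5 here).
-- Defined with fuel f ≥ n (fuel only guarantees termination; pile n uses fuel n).
pileF : ℕ → ℕ → ℕ → Pos
pileF a zero n = if even? n then *L else *R
pileF a (suc f) n with 2 ≤ᵇ n | a ≤ᵇ n
... | false | false = if even? n then *L else *R
... | true  | false = node (pileF a f (n ∸ 2)) []
... | false | true  = node (pileF a f (n ∸ a)) []
... | true  | true  = node (pileF a f (n ∸ 2)) (pileF a f (n ∸ a) ∷ [])

pile : ℕ → ℕ → Pos
pile k n = pileF (4 * k + 1) n n

-- A position is determined up to equivalence by the pair of booleans "Left wins
-- G + X moving first / moving second" for every X.  A pile of n tokens satisfies
-- P n = {P (n - 2)} for 2 ≤ n < a and P n = {P (n - 2), P (n - a)} for n ≥ a (a = 4k + 1), so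
-- any sequence satisfying this recurrence up to equivalence is equivalent to the piles.  The
-- periodic sequence W n = table k (n mod (4k + 3)) does: residue by residue the recurrence
-- reduces to a handful of identities between small positions.  These are decided by
-- evaluation: for a finite set T of positions closed under taking options, the vector of
-- pairs for t + X (t ∈ T) is determined by the vectors of the options of X, so the vectors
-- reachable from *L and *R form a computable finite set, and positions of T agreeing on all
-- of it are equivalent.
module Submission where

open import Defs
open import Data.Bool using (Bool; true; false; _∨_; _∧_; if_then_else_)
open import Data.Bool.Properties
  using (∨-assoc; ∧-assoc; ∨-comm; ∧-comm; ∨-idem; ∧-idem) renaming (_≟_ to _≟ᵇ_)
open import Data.List using (List; []; _∷_; _++_; map; zipWith; concatMap; deduplicate; length)
import Data.List.Properties as List
open import Data.List.Relation.Unary.All using (All; []; _∷_; tabulate; all?) renaming (lookup to lookupAll)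
open import Data.List.Relation.Unary.Any using (here; there)
open import Data.List.Membership.Propositional using (_∈_)
import Data.List.Membership.DecPropositional as DecMembership
open import Data.Nat using (ℕ; zero; suc; _+_; _*_; _^_; _∸_; _≤_; _<_; _≤ᵇ_; _≡ᵇ_; z≤n; s≤s)
open import Data.Nat.Properties
  using (≤ᵇ-reflects-≤; ≤-refl; ≤-reflexive; ≤-trans; ≤-<-trans; <-≤-trans; ≤-pred; ≰⇒>; n<1+n; m≤m+n; m≤n+m;
         +-assoc; +-comm; +-identityʳ; *-suc; +-cancelˡ-≤; +-cancelʳ-≤; +-monoʳ-≤; +-monoʳ-<; +-monoˡ-<;
         *-monoʳ-≤; *-monoʳ-<; ∸-monoʳ-≤; ∸-monoˡ-≤; m∸n≤m; m+[n∸m]≡n; m∸n+n≡m; m+n∸n≡m)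
open import Data.Nat.DivMod using (_%_; m<n⇒m%n≡m; [m+n]%n≡m%n; %-distribˡ-+; m%n%n≡m%n; m%n<n)
open import Data.Nat.Tactic.RingSolver using (solve-∀)
-- Data.Product's _,_ is not opened: it would make the notation ⟪_,_⟫ of Defs ambiguous.
open import Data.Product using (_×_; _,′_; uncurry; <_,_>)
import Data.Product as Σ
open import Relation.Binary using (DecidableEquality; IsEquivalence; Setoid)
import Relation.Binary.Reasoning.Setoid
open import Relation.Binary.PropositionalEquality
  using (_≡_; refl; sym; trans; cong; cong₂; subst; module ≡-Reasoning)
open import Relation.Nullary using (¬_; Dec; yes; no; does; contradiction; ofʸ; ofⁿ)
open import Relation.Nullary.Decidable using (True; toWitness; _×-dec_; map′)

record Wins : Set where
  constructor mkWins
  field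
    leftFirst  : Bool
    rightFirst : Bool
open Wins

wins : Pos → Wins
wins G = mkWins (leftWinsL G) (leftWinsR G)

toOutcome : Wins → Outcome
toOutcome (mkWins true  true)  = 𝓛
toOutcome (mkWins false false) = 𝓡
toOutcome (mkWins true  false) = 𝓝
toOutcome (mkWins false true)  = 𝓟

outcome≡toOutcome∘wins : ∀ G → outcome G ≡ toOutcome (wins G)
outcome≡toOutcome∘wins G with leftWinsL G | leftWinsR G
... | true  | true  = refl
... | false | false = refl
... | true  | false = refl
... | false | true  = refl

_⊔_ : Wins → Wins → Wins
mkWins a b ⊔ mkWins c d = mkWins (a ∨ c) (b ∧ d)

infixr 6 _⊔_

⊔-assoc : ∀ u v w → (u ⊔ v) ⊔ w ≡ u ⊔ (v ⊔ w)
⊔-assoc (mkWins a b) (mkWins c d) (mkWins e f) = cong₂ mkWins (∨-assoc a c e) (∧-assoc b d f)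

⊔-comm : ∀ u v → u ⊔ v ≡ v ⊔ u
⊔-comm (mkWins a b) (mkWins c d) = cong₂ mkWins (∨-comm a c) (∧-comm b d)

⊔-idem : ∀ u → u ⊔ u ≡ u
⊔-idem (mkWins a b) = cong₂ mkWins (∨-idem a) (∧-idem b)

⊔-left-comm : ∀ u v w → u ⊔ (v ⊔ w) ≡ v ⊔ (u ⊔ w)
⊔-left-comm u v w = begin
  u ⊔ (v ⊔ w)  ≡⟨ sym (⊔-assoc u v w) ⟩
  (u ⊔ v) ⊔ w  ≡⟨ cong (_⊔ w) (⊔-comm u v) ⟩
  (v ⊔ u) ⊔ w  ≡⟨ ⊔-assoc v u w ⟩
  v ⊔ (u ⊔ w)  ∎
  where open ≡-Reasoning

-- Moving to G′ hands the turn over, so the option G′ contributes swap (wins G′), and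
-- wins (node g gs) is definitionally swap (wins g) ⊔ optsWins gs.
swap : Wins → Wins
swap (mkWins a b) = mkWins b a

optsWins : Opts → Wins
optsWins gs = mkWins (anyR gs) (allL gs)

optsWins-++ₒ : ∀ xs ys → optsWins (xs ++ₒ ys) ≡ optsWins xs ⊔ optsWins ys
optsWins-++ₒ []       ys = refl
optsWins-++ₒ (x ∷ xs) ys = trans (cong (swap (wins x) ⊔_) (optsWins-++ₒ xs ys))
                                 (sym (⊔-assoc (swap (wins x)) (optsWins xs) (optsWins ys)))

record _≈_ (G H : Pos) : Set where
  constructor mk≈
  field sameWins : ∀ X → wins (G ⊕ X) ≡ wins (H ⊕ X)
open _≈_

infix 4 _≈_

≈-isEquivalence : IsEquivalence _≈_
≈-isEquivalence = record
  { refl  = mk≈ λ _ → refl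
  ; sym   = λ G≈H → mk≈ λ X → sym (sameWins G≈H X)
  ; trans = λ G≈H H≈K → mk≈ λ X → trans (sameWins G≈H X) (sameWins H≈K X)
  }

≈-setoid : Setoid _ _
≈-setoid = record { isEquivalence = ≈-isEquivalence }

open IsEquivalence ≈-isEquivalence public
  using () renaming (refl to ≈-refl; sym to ≈-sym; trans to ≈-trans; reflexive to ≈-reflexive)

module ≈-Reasoning = Relation.Binary.Reasoning.Setoid ≈-setoid

≈⇒≡ᵍ : ∀ {G H} → G ≈ H → G ≡ᵍ H
≈⇒≡ᵍ {G} {H} G≈H X = begin
  outcome (G ⊕ X)            ≡⟨ outcome≡toOutcome∘wins (G ⊕ X) ⟩
  toOutcome (wins (G ⊕ X))   ≡⟨ cong toOutcome (sameWins G≈H X) ⟩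
  toOutcome (wins (H ⊕ X))   ≡⟨ outcome≡toOutcome∘wins (H ⊕ X) ⟨
  outcome (H ⊕ X)            ∎
  where open ≡-Reasoning

mapOpts : (Pos → Pos) → Opts → Opts
mapOpts f []       = []
mapOpts f (g ∷ gs) = f g ∷ mapOpts f gs

options : Pos → Opts
options *L          = []
options *R          = []
options (node g gs) = g ∷ gs

lsum≡mapOpts : ∀ gs X → lsum gs X ≡ mapOpts (_⊕ X) gs
lsum≡mapOpts []       X = refl
lsum≡mapOpts (g ∷ gs) X = cong ((g ⊕ X) ∷_) (lsum≡mapOpts gs X)

rsum≡mapOpts : ∀ t hs → rsum t hs ≡ mapOpts (t ⊕_) hs
rsum≡mapOpts t []       = refl
rsum≡mapOpts t (h ∷ hs) = cong ((t ⊕ h) ∷_) (rsum≡mapOpts t hs)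

rsumN≡mapOpts : ∀ g gs X → rsumN g gs X ≡ mapOpts (node g gs ⊕_) (options X)
rsumN≡mapOpts g gs *L          = refl
rsumN≡mapOpts g gs *R          = refl
rsumN≡mapOpts g gs (node h hs) = cong ((node g gs ⊕ h) ∷_) (rsumN′≡mapOpts hs)
  where
    rsumN′≡mapOpts : ∀ hs → rsumN' g gs hs ≡ mapOpts (node g gs ⊕_) hs
    rsumN′≡mapOpts []       = refl
    rsumN′≡mapOpts (h ∷ hs) = cong ((node g gs ⊕ h) ∷_) (rsumN′≡mapOpts hs)

leftMoveWins : Opts → Pos → Wins
leftMoveWins gs X = optsWins (mapOpts (_⊕ X) gs)

rightMoveWins : Opts → Pos → Wins
rightMoveWins hs G = optsWins (mapOpts (G ⊕_) hs)

wins-node-⊕ : ∀ g gs X → wins (node g gs ⊕ X) ≡ leftMoveWins (g ∷ gs) X ⊔ rightMoveWins (options X) (node g gs)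
wins-node-⊕ g gs X = begin
  swap (wins (g ⊕ X)) ⊔ optsWins (lsum gs X ++ₒ rsumN g gs X)
    ≡⟨ cong (swap (wins (g ⊕ X)) ⊔_) (optsWins-++ₒ (lsum gs X) (rsumN g gs X)) ⟩
  swap (wins (g ⊕ X)) ⊔ optsWins (lsum gs X) ⊔ optsWins (rsumN g gs X)
    ≡⟨ sym (⊔-assoc (swap (wins (g ⊕ X))) _ _) ⟩
  optsWins (lsum (g ∷ gs) X) ⊔ optsWins (rsumN g gs X)
    ≡⟨ cong₂ (λ ls rs → optsWins ls ⊔ optsWins rs) (lsum≡mapOpts (g ∷ gs) X) (rsumN≡mapOpts g gs X) ⟩
  leftMoveWins (g ∷ gs) X ⊔ rightMoveWins (options X) (node g gs) ∎
  where open ≡-Reasoning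

node-≈ : ∀ {g g′ gs gs′} → (∀ X → leftMoveWins (g ∷ gs) X ≡ leftMoveWins (g′ ∷ gs′) X) →
         node g gs ≈ node g′ gs′
node-≈ {g} {g′} {gs} {gs′} sameMoves = mk≈ same
  where
    G  = node g gs
    G′ = node g′ gs′

    mutual
      same : ∀ X → wins (G ⊕ X) ≡ wins (G′ ⊕ X)
      same X = begin
        wins (G ⊕ X)                                            ≡⟨ wins-node-⊕ g gs X ⟩
        leftMoveWins (g ∷ gs) X ⊔ rightMoveWins (options X) G     ≡⟨ cong₂ _⊔_ (sameMoves X) (sameReplies X) ⟩
        leftMoveWins (g′ ∷ gs′) X ⊔ rightMoveWins (options X) G′  ≡⟨ wins-node-⊕ g′ gs′ X ⟨
        wins (G′ ⊕ X)                                           ∎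
        where open ≡-Reasoning

      sameReplies : ∀ X → rightMoveWins (options X) G ≡ rightMoveWins (options X) G′
      sameReplies *L          = refl
      sameReplies *R          = refl
      sameReplies (node h hs) = cong₂ _⊔_ (cong swap (same h)) (sameRepliesOpts hs)

      sameRepliesOpts : ∀ hs → rightMoveWins hs G ≡ rightMoveWins hs G′
      sameRepliesOpts []       = refl
      sameRepliesOpts (h ∷ hs) = cong₂ _⊔_ (cong swap (same h)) (sameRepliesOpts hs)

data _≈ₒ_ : Opts → Opts → Set where
  []  : [] ≈ₒ []
  _∷_ : ∀ {g g′ gs gs′} → g ≈ g′ → gs ≈ₒ gs′ → (g ∷ gs) ≈ₒ (g′ ∷ gs′)

leftMoveWins-cong : ∀ {gs gs′} → gs ≈ₒ gs′ → ∀ X → leftMoveWins gs X ≡ leftMoveWins gs′ X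
leftMoveWins-cong []               X = refl
leftMoveWins-cong (g≈g′ ∷ gs≈gs′) X = cong₂ _⊔_ (cong swap (sameWins g≈g′ X)) (leftMoveWins-cong gs≈gs′ X)

node-cong : ∀ {g g′ gs gs′} → g ≈ g′ → gs ≈ₒ gs′ → node g gs ≈ node g′ gs′
node-cong g≈g′ gs≈gs′ = node-≈ (leftMoveWins-cong (g≈g′ ∷ gs≈gs′))

⟪⟫-cong : ∀ {G G′} → G ≈ G′ → ⟪ G ⟫ ≈ ⟪ G′ ⟫
⟪⟫-cong G≈G′ = node-cong G≈G′ []

⟪,⟫-cong : ∀ {G G′ H H′} → G ≈ G′ → H ≈ H′ → ⟪ G , H ⟫ ≈ ⟪ G′ , H′ ⟫
⟪,⟫-cong G≈G′ H≈H′ = node-cong G≈G′ (H≈H′ ∷ [])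

⟪,⟫-comm : ∀ G H → ⟪ G , H ⟫ ≈ ⟪ H , G ⟫
⟪,⟫-comm G H = node-≈ λ X → ⊔-left-comm (swap (wins (G ⊕ X))) (swap (wins (H ⊕ X))) (leftMoveWins [] X)

⟪,⟫-idem : ∀ G → ⟪ G , G ⟫ ≈ ⟪ G ⟫
⟪,⟫-idem G = node-≈ λ X → let u = swap (wins (G ⊕ X)) ; none = leftMoveWins [] X in
  trans (sym (⊔-assoc u u none)) (cong (_⊔ none) (⊔-idem u))

_≟ʷ_ : DecidableEquality Wins
mkWins a b ≟ʷ mkWins c d =
  map′ (uncurry (cong₂ mkWins)) < cong leftFirst , cong rightFirst > (a ≟ᵇ c ×-dec b ≟ᵇ d)

mutual
  _≟ₚ_ : DecidableEquality Pos
  *L        ≟ₚ *L        = yes refl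
  *L        ≟ₚ *R        = no λ ()
  *L        ≟ₚ node _ _  = no λ ()
  *R        ≟ₚ *L        = no λ ()
  *R        ≟ₚ *R        = yes refl
  *R        ≟ₚ node _ _  = no λ ()
  node _ _  ≟ₚ *L        = no λ ()
  node _ _  ≟ₚ *R        = no λ ()
  node g gs ≟ₚ node h hs =
    map′ (uncurry (cong₂ node)) < (λ { refl → refl }) , (λ { refl → refl }) > (g ≟ₚ h ×-dec gs ≟ₒ hs)

  _≟ₒ_ : DecidableEquality Opts
  []       ≟ₒ []       = yes refl
  []       ≟ₒ (_ ∷ _)  = no λ ()
  (_ ∷ _)  ≟ₒ []       = no λ ()
  (g ∷ gs) ≟ₒ (h ∷ hs) =
    map′ (uncurry (cong₂ _∷_)) < (λ { refl → refl }) , (λ { refl → refl }) > (g ≟ₚ h ×-dec gs ≟ₒ hs)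

optsList : Opts → List Pos
optsList []       = []
optsList (g ∷ gs) = g ∷ optsList gs

Profile : Set
Profile = List Wins

_≟ᵖ_ : DecidableEquality Profile
_≟ᵖ_ = List.≡-dec _≟ʷ_

profile : List Pos → Pos → Profile
profile T X = map (λ t → wins (t ⊕ X)) T

repliesProfile : List Pos → Opts → Profile
repliesProfile T hs = map (rightMoveWins hs) T

addOption : Profile → Profile → Profile
addOption = zipWith (λ w r → swap w ⊔ r)

repliesProfile-∷ : ∀ T h hs → repliesProfile T (h ∷ hs) ≡ addOption (profile T h) (repliesProfile T hs)
repliesProfile-∷ []      h hs = refl
repliesProfile-∷ (t ∷ T) h hs = cong (_ ∷_) (repliesProfile-∷ T h hs)

-- winsFromReplies (rightMoveWins (options X)) t recomputes wins (t ⊕ X) for a non-terminal X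
-- by recursion on t (wins-⊕-node), using X only through its replies.
mutual
  winsFromReplies : (Pos → Wins) → Pos → Wins
  winsFromReplies r *L          = r *L
  winsFromReplies r *R          = r *R
  winsFromReplies r (node g gs) = (swap (winsFromReplies r g) ⊔ optsWinsFromReplies r gs) ⊔ r (node g gs)

  optsWinsFromReplies : (Pos → Wins) → Opts → Wins
  optsWinsFromReplies r []       = mkWins false true
  optsWinsFromReplies r (g ∷ gs) = swap (winsFromReplies r g) ⊔ optsWinsFromReplies r gs

module _ (h : Pos) (hs : Opts) where
  mutual
    wins-⊕-node : ∀ t → wins (t ⊕ node h hs) ≡ winsFromReplies (rightMoveWins (h ∷ hs)) t
    wins-⊕-node *L          = cong (λ rs → optsWins ((*L ⊕ h) ∷ rs)) (rsum≡mapOpts *L hs)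
    wins-⊕-node *R          = cong (λ rs → optsWins ((*R ⊕ h) ∷ rs)) (rsum≡mapOpts *R hs)
    wins-⊕-node (node g gs) = trans (wins-node-⊕ g gs (node h hs))
      (cong (_⊔ rightMoveWins (h ∷ hs) (node g gs))
            (cong₂ _⊔_ (cong swap (wins-⊕-node g)) (leftMoveWins-⊕-node gs)))

    leftMoveWins-⊕-node : ∀ gs → leftMoveWins gs (node h hs) ≡ optsWinsFromReplies (rightMoveWins (h ∷ hs)) gs
    leftMoveWins-⊕-node []       = refl
    leftMoveWins-⊕-node (g ∷ gs) = cong₂ _⊔_ (cong swap (wins-⊕-node g)) (leftMoveWins-⊕-node gs)

-- The default value is never used on members of T (lookupWins-map).
lookupWins : List Pos → Profile → Pos → Wins
lookupWins (t ∷ T) (w ∷ ws) u = if does (u ≟ₚ t) then w else lookupWins T ws u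
lookupWins _       _        u = mkWins false false

lookupWins-map : ∀ {T} (f : Pos → Wins) {u} → u ∈ T → lookupWins T (map f T) u ≡ f u
lookupWins-map {t ∷ T} f {u} u∈T with u ≟ₚ t | u∈T
... | yes refl | _          = refl
... | no u≢t   | here u≡t   = contradiction u≡t u≢t
... | no _     | there u∈T′ = lookupWins-map f u∈T′

Closed : List Pos → Set
Closed T = All (λ t → All (_∈ T) (optsList (options t))) T

module _ {T : List Pos} (closed : Closed T) {r r′ : Pos → Wins} (r≡r′ : ∀ {u} → u ∈ T → r u ≡ r′ u) where
  mutual
    winsFromReplies-local : ∀ t → t ∈ T → winsFromReplies r t ≡ winsFromReplies r′ t
    winsFromReplies-local *L          t∈T = r≡r′ t∈T
    winsFromReplies-local *R          t∈T = r≡r′ t∈T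
    winsFromReplies-local (node g gs) t∈T with lookupAll closed t∈T
    ... | g∈T ∷ gs∈T = cong₂ _⊔_
      (cong₂ _⊔_ (cong swap (winsFromReplies-local g g∈T)) (optsWinsFromReplies-local gs gs∈T)) (r≡r′ t∈T)

    optsWinsFromReplies-local : ∀ gs → All (_∈ T) (optsList gs) → optsWinsFromReplies r gs ≡ optsWinsFromReplies r′ gs
    optsWinsFromReplies-local []       []            = refl
    optsWinsFromReplies-local (g ∷ gs) (g∈T ∷ gs∈T) =
      cong₂ _⊔_ (cong swap (winsFromReplies-local g g∈T)) (optsWinsFromReplies-local gs gs∈T)

nodeProfile : List Pos → Profile → Profile
nodeProfile T rs = map (winsFromReplies (lookupWins T rs)) T

profile-node : ∀ {T} → Closed T → ∀ h hs → profile T (node h hs) ≡ nodeProfile T (repliesProfile T (h ∷ hs))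
profile-node closed h hs = List.map-cong-local (tabulate λ {t} t∈T →
  trans (wins-⊕-node h hs t)
        (winsFromReplies-local closed (λ u∈T → sym (lookupWins-map (rightMoveWins (h ∷ hs)) u∈T)) t t∈T))

-- C over-approximates {profile T X | X}, and S the profiles of replies to non-empty option lists.
record Certificate (G H : Pos) (T : List Pos) (C S : List Profile) : Set where
  field
    closed      : Closed T
    G∈T         : G ∈ T
    H∈T         : H ∈ T
    *L∈C        : profile T *L ∈ C
    *R∈C        : profile T *R ∈ C
    single∈S    : All (λ v → addOption v (repliesProfile T []) ∈ S) C
    addOption∈S : All (λ v → All (λ u → addOption v u ∈ S) S) C
    node∈C      : All (λ u → nodeProfile T u ∈ C) S
    agree       : All (λ v → lookupWins T v G ≡ lookupWins T v H) C

module _ {G H T C S} (cert : Certificate G H T C S) where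
  open Certificate cert

  mutual
    profile∈C : ∀ X → profile T X ∈ C
    profile∈C *L          = *L∈C
    profile∈C *R          = *R∈C
    profile∈C (node h hs) =
      subst (_∈ C) (sym (profile-node closed h hs)) (lookupAll node∈C (repliesProfile∈S h hs))

    repliesProfile∈S : ∀ h hs → repliesProfile T (h ∷ hs) ∈ S
    repliesProfile∈S h []         =
      subst (_∈ S) (sym (repliesProfile-∷ T h [])) (lookupAll single∈S (profile∈C h))
    repliesProfile∈S h (h′ ∷ hs) =
      subst (_∈ S) (sym (repliesProfile-∷ T h (h′ ∷ hs)))
            (lookupAll (lookupAll addOption∈S (profile∈C h)) (repliesProfile∈S h′ hs))

  ≈-from-certificate : G ≈ H
  ≈-from-certificate = mk≈ λ X →
    trans (sym (lookupWins-map (λ t → wins (t ⊕ X)) G∈T))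
          (trans (lookupAll agree (profile∈C X)) (lookupWins-map (λ t → wins (t ⊕ X)) H∈T))

certificate? : ∀ G H T C S → Dec (Certificate G H T C S)
certificate? G H T C S = map′ fromChecks toChecks
  ( all? (λ t → all? (_∈? T) (optsList (options t))) T
  ×-dec G ∈? T ×-dec H ∈? T
  ×-dec profile T *L ∈ᵖ? C ×-dec profile T *R ∈ᵖ? C
  ×-dec all? (λ v → addOption v (repliesProfile T []) ∈ᵖ? S) C
  ×-dec all? (λ v → all? (λ u → addOption v u ∈ᵖ? S) S) C
  ×-dec all? (λ u → nodeProfile T u ∈ᵖ? C) S
  ×-dec all? (λ v → lookupWins T v G ≟ʷ lookupWins T v H) C )
  where
    open Σ using (_,_)
    open DecMembership _≟ₚ_ using (_∈?_)
    open DecMembership _≟ᵖ_ using () renaming (_∈?_ to _∈ᵖ?_)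
    fromChecks = λ (a , b , c , d , e , f , g , h , i) → record
      { closed = a ; G∈T = b ; H∈T = c ; *L∈C = d ; *R∈C = e
      ; single∈S = f ; addOption∈S = g ; node∈C = h ; agree = i }
    toChecks = λ (cert : Certificate G H T C S) → let open Certificate cert in
      closed , G∈T , H∈T , *L∈C , *R∈C , single∈S , addOption∈S , node∈C , agree

mutual
  subterms : Pos → List Pos
  subterms *L          = *L ∷ []
  subterms *R          = *R ∷ []
  subterms (node g gs) = node g gs ∷ subterms g ++ optsSubterms gs

  optsSubterms : Opts → List Pos
  optsSubterms []       = []
  optsSubterms (g ∷ gs) = subterms g ++ optsSubterms gs

record Candidates : Set where
  constructor candidates
  field
    profiles      : List Profile
    replyProfiles : List Profile

_∪_ : List Profile → List Profile → List Profile
xs ∪ ys = deduplicate _≟ᵖ_ (xs ++ ys)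

grow : List Pos → Candidates → Candidates
grow T (candidates C S) = candidates
  (C ∪ map (nodeProfile T) S)
  (S ∪ (map (λ v → addOption v (repliesProfile T [])) C ++ concatMap (λ v → map (addOption v) S) C))

saturate : ℕ → List Pos → Candidates → Candidates
saturate zero    T cs = cs
saturate (suc n) T cs with grow T cs
... | cs′ = if size cs′ ≡ᵇ size cs then cs else saturate n T cs′
  where
    size : Candidates → ℕ
    size (candidates C S) = length C + length S

-- Each round stops or adds a profile to one of two lists of at most 4 ^ length T distinct
-- profiles, so the fuel suffices; soundness does not depend on it, as the result is checked.
reachable : List Pos → Candidates
reachable T = saturate (2 * 4 ^ length T) T (candidates (profile T *L ∷ profile T *R ∷ []) [])

universe : Pos → Pos → List Pos
universe G H = deduplicate _≟ₚ_ (subterms G ++ subterms H)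

Certified : Pos → Pos → Set
Certified G H = Certificate G H (universe G H) profiles replyProfiles
  where open Candidates (reachable (universe G H))

certified? : ∀ G H → Dec (Certified G H)
certified? G H = certificate? G H (universe G H) profiles replyProfiles
  where open Candidates (reachable (universe G H))

≈-by-evaluation : ∀ {G H} {checked : True (certified? G H)} → G ≈ H
≈-by-evaluation {checked = checked} = ≈-from-certificate (toWitness checked)

⟪⟪*L⟫⟫≈*L : ⟪ ⟪ *L ⟫ ⟫ ≈ *L
⟪⟪*L⟫⟫≈*L = ≈-by-evaluation

⟪⟪*R⟫⟫≈*R : ⟪ ⟪ *R ⟫ ⟫ ≈ *R
⟪⟪*R⟫⟫≈*R = ≈-by-evaluation

⟪⟪*L⟫,⟪*L,*R⟫⟫≈*L : ⟪ ⟪ *L ⟫ , ⟪ *L , *R ⟫ ⟫ ≈ *L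
⟪⟪*L⟫,⟪*L,*R⟫⟫≈*L = ≈-by-evaluation

⟪⟪*L,⟪*R⟫⟫,⟪*L⟫⟫≈*L : ⟪ ⟪ *L , ⟪ *R ⟫ ⟫ , ⟪ *L ⟫ ⟫ ≈ *L
⟪⟪*L,⟪*R⟫⟫,⟪*L⟫⟫≈*L = ≈-by-evaluation

⟪⟪*L,*R⟫,⟪*R⟫⟫≈*R : ⟪ ⟪ *L , *R ⟫ , ⟪ *R ⟫ ⟫ ≈ *R
⟪⟪*L,*R⟫,⟪*R⟫⟫≈*R = ≈-by-evaluation

⟪*R,⟪*L,⟪*R⟫⟫⟫≈⟪*R⟫ : ⟪ *R , ⟪ *L , ⟪ *R ⟫ ⟫ ⟫ ≈ ⟪ *R ⟫
⟪*R,⟪*L,⟪*R⟫⟫⟫≈⟪*R⟫ = ≈-by-evaluation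

∸-≤-pred : ∀ {n f b} → n ≤ suc f → 1 ≤ b → n ∸ b ≤ f
∸-≤-pred {n} n≤1+f 1≤b = ≤-trans (∸-monoʳ-≤ n 1≤b) (∸-monoˡ-≤ 1 n≤1+f)

module _ (a : ℕ) (2≤a : 2 ≤ a) (W : ℕ → Pos)
         (W₀ : *L ≈ W 0) (W₁ : *R ≈ W 1)
         (recurrence-short : ∀ n → 2 ≤ n → n < a → ⟪ W (n ∸ 2) ⟫ ≈ W n)
         (recurrence-long : ∀ n → a ≤ n → ⟪ W (n ∸ 2) , W (n ∸ a) ⟫ ≈ W n) where

  pileF-≈ : ∀ f n → n ≤ f → pileF a f n ≈ W n
  pileF-≈ zero    zero    _  = W₀
  pileF-≈ (suc f) n       n≤ with 2 ≤ᵇ n | ≤ᵇ-reflects-≤ 2 n | a ≤ᵇ n | ≤ᵇ-reflects-≤ a n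
  ... | false | ofⁿ 2≰n | false | _       = terminal n 2≰n
    where
      terminal : ∀ n → ¬ 2 ≤ n → (if even? n then *L else *R) ≈ W n
      terminal 0 _ = W₀
      terminal 1 _ = W₁
      terminal (suc (suc n)) 2≰n = contradiction (s≤s (s≤s z≤n)) 2≰n
  ... | false | ofⁿ 2≰n | true  | ofʸ a≤n = contradiction (≤-trans 2≤a a≤n) 2≰n
  ... | true  | ofʸ 2≤n | false | ofⁿ a≰n = begin
    ⟪ pileF a f (n ∸ 2) ⟫ ≈⟨ ⟪⟫-cong (pileF-≈ f (n ∸ 2) (∸-≤-pred n≤ (s≤s z≤n))) ⟩
    ⟪ W (n ∸ 2) ⟫        ≈⟨ recurrence-short n 2≤n (≰⇒> a≰n) ⟩
    W n                  ∎
    where open ≈-Reasoning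
  ... | true  | ofʸ _   | true  | ofʸ a≤n = begin
    ⟪ pileF a f (n ∸ 2) , pileF a f (n ∸ a) ⟫
      ≈⟨ ⟪,⟫-cong (pileF-≈ f (n ∸ 2) (∸-≤-pred n≤ (s≤s z≤n))) (pileF-≈ f (n ∸ a) (∸-≤-pred n≤ (≤-trans (s≤s z≤n) 2≤a))) ⟩
    ⟪ W (n ∸ 2) , W (n ∸ a) ⟫
      ≈⟨ recurrence-long n a≤n ⟩
    W n ∎
    where open ≈-Reasoning

table : ℕ → ℕ → Pos
table zero    0 = *L
table zero    1 = ⟪ *L , ⟪ *R ⟫ ⟫
table zero    _ = ⟪ *L , *R ⟫
table (suc k) 0 = *L
table (suc k) 1 = *R
table (suc k) 2 = ⟪ *L ⟫
table (suc k) 3 = ⟪ *R ⟫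
table (suc k) (suc (suc (suc (suc r)))) = table k r

4*[1+m]+n≡4+[4*m+n] : ∀ m n → 4 * suc m + n ≡ 4 + (4 * m + n)
4*[1+m]+n≡4+[4*m+n] m n = trans (cong (_+ n) (*-suc 4 m)) (+-assoc 4 (4 * m) n)

table-block : ∀ {k ℓ} r → ℓ < k → table k (4 * ℓ + r) ≡ table (suc (k ∸ suc ℓ)) r
table-block {suc k} {zero}  r _           = refl
table-block {suc k} {suc ℓ} r (s≤s ℓ<k) =
  trans (cong (table (suc k)) (4*[1+m]+n≡4+[4*m+n] ℓ r)) (table-block r ℓ<k)

table-last : ∀ k r → table k (4 * k + r) ≡ table 0 r
table-last zero    r = refl
table-last (suc k) r = trans (cong (table (suc k)) (4*[1+m]+n≡4+[4*m+n] k r)) (table-last k r)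

drop-block : ∀ k {m} → 4 + m ≤ 4 * suc k → m ≤ 4 * k
drop-block k {m} h = +-cancelˡ-≤ 4 m (4 * k) (≤-trans h (≤-reflexive (*-suc 4 k)))

table-short : ∀ k m → 2 + m ≤ 4 * k → ⟪ table k m ⟫ ≈ table k (2 + m)
table-short (suc k)       0 _ = ≈-refl
table-short (suc k)       1 _ = ≈-refl
table-short (suc zero)    2 _ = ⟪⟪*L⟫⟫≈*L
table-short (suc (suc k)) 2 _ = ⟪⟪*L⟫⟫≈*L
table-short (suc zero)    3 (s≤s (s≤s (s≤s (s≤s ()))))
table-short (suc (suc k)) 3 _ = ⟪⟪*R⟫⟫≈*R
table-short (suc k) (suc (suc (suc (suc m)))) h = table-short k m (drop-block k h)

table-long : ∀ k m → 2 + m ≤ 4 * k → ⟪ table k m , table k (4 + m) ⟫ ≈ table k (2 + m)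
table-long (suc zero)    0 _ = ⟪,⟫-idem *L
table-long (suc (suc k)) 0 _ = ⟪,⟫-idem *L
table-long (suc zero)    1 _ = ⟪*R,⟪*L,⟪*R⟫⟫⟫≈⟪*R⟫
table-long (suc (suc k)) 1 _ = ⟪,⟫-idem *R
table-long (suc zero)    2 _ = ⟪⟪*L⟫,⟪*L,*R⟫⟫≈*L
table-long (suc (suc k)) 2 _ = ≈-trans (⟪,⟫-idem ⟪ *L ⟫) ⟪⟪*L⟫⟫≈*L
table-long (suc zero)    3 (s≤s (s≤s (s≤s (s≤s ()))))
table-long (suc (suc k)) 3 _ = ≈-trans (⟪,⟫-idem ⟪ *R ⟫) ⟪⟪*R⟫⟫≈*R
table-long (suc k) (suc (suc (suc (suc m)))) h = table-long k m (drop-block k h)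

[1+i]+[4j+3]≡4[1+j]+i : ∀ j i → (1 + i) + (4 * j + 3) ≡ 4 * suc j + i
[1+i]+[4j+3]≡4[1+j]+i = solve-∀

[4+t]+[4j+3]≡t+[4[1+j]+3] : ∀ j t → (4 + t) + (4 * j + 3) ≡ t + (4 * suc j + 3)
[4+t]+[4j+3]≡t+[4[1+j]+3] = solve-∀

[2+t]+[4[1+j]+1]≡t+[4[1+j]+3] : ∀ j t → (2 + t) + (4 * suc j + 1) ≡ t + (4 * suc j + 3)
[2+t]+[4[1+j]+1]≡t+[4[1+j]+3] = solve-∀

4[1+j]+1≡[4j+3]+2 : ∀ j → 4 * suc j + 1 ≡ (4 * j + 3) + 2
4[1+j]+1≡[4j+3]+2 = solve-∀

1+[4k+1]≡4k+2 : ∀ k → 1 + (4 * k + 1) ≡ 4 * k + 2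
1+[4k+1]≡4k+2 = solve-∀

module PeriodicSolution (j : ℕ) where
  k a p c : ℕ
  k = suc j
  a = 4 * k + 1
  p = 4 * k + 3
  c = 4 * j + 3

  W : ℕ → Pos
  W n = table k (n % p)

  W-small : ∀ {n} → n < p → W n ≡ table k n
  W-small n<p = cong (table k) (m<n⇒m%n≡m n<p)

  W-periodic : ∀ n → W (n + p) ≡ W n
  W-periodic n = cong (table k) ([m+n]%n≡m%n n p)

  W-+-mod : ∀ m n → W (m + n) ≡ W (m % p + n)
  W-+-mod m n = cong (table k) (begin
    (m + n) % p               ≡⟨ %-distribˡ-+ m n p ⟩
    (m % p + n % p) % p       ≡⟨ cong (λ x → (x + n % p) % p) (sym (m%n%n≡m%n m p)) ⟩
    (m % p % p + n % p) % p   ≡⟨ sym (%-distribˡ-+ (m % p) n p) ⟩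
    (m % p + n) % p           ∎)
    where open ≡-Reasoning

  W-mod : ∀ m → W m ≡ W (m % p)
  W-mod m = cong (table k) (sym (m%n%n≡m%n m p))

  4≤4k : 4 ≤ 4 * k
  4≤4k = ≤-trans (m≤m+n 4 (4 * j)) (≤-reflexive (sym (*-suc 4 j)))

  2≤a : 2 ≤ a
  2≤a = ≤-trans (s≤s (s≤s z≤n)) (≤-trans 4≤4k (m≤m+n (4 * k) 1))

  3<p : 3 < p
  3<p = ≤-trans 4≤4k (m≤m+n (4 * k) 3)

  ≤3⇒<p : ∀ {i} → i ≤ 3 → i < p
  ≤3⇒<p i≤3 = ≤-<-trans i≤3 3<p

  W-last : ∀ i → i < 3 → W (4 * k + i) ≡ table 0 i
  W-last i i<3 = trans (W-small (+-monoʳ-< (4 * k) i<3)) (table-last k i)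

  W-0 : W 0 ≡ *L
  W-0 = W-small (≤3⇒<p z≤n)

  W-1 : W 1 ≡ *R
  W-1 = W-small (≤3⇒<p (s≤s z≤n))

  W-short : ∀ n → 2 ≤ n → n < a → ⟪ W (n ∸ 2) ⟫ ≈ W n
  W-short n 2≤n n<a = begin
    ⟪ W (n ∸ 2) ⟫           ≡⟨ cong ⟪_⟫ (W-small (≤-<-trans (m∸n≤m n 2) n<p)) ⟩
    ⟪ table k (n ∸ 2) ⟫     ≈⟨ table-short k (n ∸ 2) (≤-trans (≤-reflexive 2+[n∸2]≡n) n≤4k) ⟩
    table k (2 + (n ∸ 2))   ≡⟨ cong (table k) 2+[n∸2]≡n ⟩
    table k n               ≡⟨ sym (W-small n<p) ⟩
    W n                     ∎
    where
      open ≈-Reasoning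
      2+[n∸2]≡n = m+[n∸m]≡n 2≤n
      n<p = <-≤-trans n<a (+-monoʳ-≤ (4 * k) (s≤s z≤n))
      n≤4k = ≤-pred (≤-trans n<a (≤-reflexive (+-comm (4 * k) 1)))

  -- For n ≥ a and m = n ∸ a, the indices n ∸ 2, n ∸ a, n are m + c, m, m + a, so only m % p matters.
  W-long-residue : ∀ r → r < p → ⟪ W (r + c) , W r ⟫ ≈ W (r + a)
  W-long-residue 0 _ = begin
    ⟪ W c , W 0 ⟫     ≡⟨ cong₂ ⟪_,_⟫ (trans (W-small c<p) (table-block 3 (n<1+n j))) W-0 ⟩
    ⟪ ⟪ *R ⟫ , *L ⟫   ≈⟨ ⟪,⟫-comm ⟪ *R ⟫ *L ⟩
    ⟪ *L , ⟪ *R ⟫ ⟫   ≡⟨ sym (W-last 1 (s≤s (s≤s z≤n))) ⟩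
    W a               ∎
    where
      open ≈-Reasoning
      c<p = +-monoˡ-< 3 (*-monoʳ-< 4 (n<1+n j))
  W-long-residue 1 _ = begin
    ⟪ W (1 + c) , W 1 ⟫  ≡⟨ cong₂ ⟪_,_⟫ (trans (cong W ([1+i]+[4j+3]≡4[1+j]+i j 0)) (W-last 0 (s≤s z≤n))) W-1 ⟩
    ⟪ *L , *R ⟫          ≡⟨ sym (trans (cong W (1+[4k+1]≡4k+2 k)) (W-last 2 ≤-refl)) ⟩
    W (1 + a)            ∎
    where open ≈-Reasoning
  W-long-residue 2 _ = begin
    ⟪ W (2 + c) , W 2 ⟫          ≡⟨ cong₂ ⟪_,_⟫ (trans (cong W ([1+i]+[4j+3]≡4[1+j]+i j 1)) (W-last 1 (s≤s (s≤s z≤n))))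
                                                (W-small (≤3⇒<p (s≤s (s≤s z≤n)))) ⟩
    ⟪ ⟪ *L , ⟪ *R ⟫ ⟫ , ⟪ *L ⟫ ⟫ ≈⟨ ⟪⟪*L,⟪*R⟫⟫,⟪*L⟫⟫≈*L ⟩
    *L                           ≡⟨ sym (trans (cong W ([2+t]+[4[1+j]+1]≡t+[4[1+j]+3] j 0)) (trans (W-periodic 0) W-0)) ⟩
    W (2 + a)                    ∎
    where open ≈-Reasoning
  W-long-residue 3 _ = begin
    ⟪ W (3 + c) , W 3 ⟫       ≡⟨ cong₂ ⟪_,_⟫ (trans (cong W ([1+i]+[4j+3]≡4[1+j]+i j 2)) (W-last 2 ≤-refl))
                                             (W-small (≤3⇒<p ≤-refl)) ⟩
    ⟪ ⟪ *L , *R ⟫ , ⟪ *R ⟫ ⟫  ≈⟨ ⟪⟪*L,*R⟫,⟪*R⟫⟫≈*R ⟩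
    *R                        ≡⟨ sym (trans (cong W ([2+t]+[4[1+j]+1]≡t+[4[1+j]+3] j 1)) (trans (W-periodic 1) W-1)) ⟩
    W (3 + a)                 ∎
    where open ≈-Reasoning
  W-long-residue (suc (suc (suc (suc t)))) 4+t<p = begin
    ⟪ W (4 + t + c) , W (4 + t) ⟫    ≡⟨ cong₂ ⟪_,_⟫ (trans (cong W ([4+t]+[4j+3]≡t+[4[1+j]+3] j t)) (trans (W-periodic t) (W-small t<p)))
                                                    (W-small 4+t<p) ⟩
    ⟪ table k t , table k (4 + t) ⟫  ≈⟨ table-long k t 2+t≤4k ⟩
    table k (2 + t)                  ≡⟨ sym (trans (cong W ([2+t]+[4[1+j]+1]≡t+[4[1+j]+3] j (2 + t)))
                                                   (trans (W-periodic (2 + t)) (W-small 2+t<p))) ⟩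
    W (4 + t + a)                    ∎
    where
      open ≈-Reasoning
      t<p    = ≤-<-trans (m≤n+m t 4) 4+t<p
      2+t<p  = ≤-<-trans (m≤n+m (2 + t) 2) 4+t<p
      2+t≤4k = +-cancelʳ-≤ 3 (2 + t) (4 * k) (≤-trans (≤-reflexive (+-comm (2 + t) 3)) 4+t<p)

  W-long : ∀ n → a ≤ n → ⟪ W (n ∸ 2) , W (n ∸ a) ⟫ ≈ W n
  W-long n a≤n = begin
    ⟪ W (n ∸ 2) , W m ⟫   ≡⟨ cong₂ ⟪_,_⟫ (trans (cong W n∸2≡m+c) (W-+-mod m c)) (W-mod m) ⟩
    ⟪ W (r + c) , W r ⟫   ≈⟨ W-long-residue r (m%n<n m p) ⟩
    W (r + a)             ≡⟨ sym (trans (cong W n≡m+a) (W-+-mod m a)) ⟩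
    W n                   ∎
    where
      open ≈-Reasoning
      m = n ∸ a
      r = m % p
      n≡m+a : n ≡ m + a
      n≡m+a = sym (m∸n+n≡m a≤n)
      n∸2≡m+c : n ∸ 2 ≡ m + c
      n∸2≡m+c = trans (cong (λ x → x ∸ 2) (trans n≡m+a (cong (m +_) (4[1+j]+1≡[4j+3]+2 j))))
                      (trans (cong (_∸ 2) (sym (+-assoc m c 2))) (m+n∸n≡m (m + c) 2))

  pile≈W : ∀ n → pile k n ≈ W n
  pile≈W n = pileF-≈ a 2≤a W (≈-reflexive (sym W-0)) (≈-reflexive (sym W-1)) W-short W-long n n ≤-refl

  pile-periodic : ∀ n → pile k (n + p) ≡ᵍ pile k n
  pile-periodic n = ≈⇒≡ᵍ (begin
    pile k (n + p)  ≈⟨ pile≈W (n + p) ⟩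
    W (n + p)       ≡⟨ W-periodic n ⟩
    W n             ≈⟨ ≈-sym (pile≈W n) ⟩
    pile k n        ∎)
    where open ≈-Reasoning

  pile-block : ∀ ℓ → ℓ < k →
    (pile k (4 * ℓ) ≡ᵍ *L) × (pile k (4 * ℓ + 1) ≡ᵍ *R) × (pile k (4 * ℓ + 2) ≡ᵍ ⟪ *L ⟫) × (pile k (4 * ℓ + 3) ≡ᵍ ⟪ *R ⟫)
  pile-block ℓ ℓ<k =
    ≈⇒≡ᵍ (≈-trans (≈-reflexive (cong (pile k) (sym (+-identityʳ (4 * ℓ))))) (entry 0 z≤n))
    ,′ ≈⇒≡ᵍ (entry 1 (s≤s z≤n)) ,′ ≈⇒≡ᵍ (entry 2 (s≤s (s≤s z≤n))) ,′ ≈⇒≡ᵍ (entry 3 ≤-refl)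
    where
      4ℓ+4≤4k : 4 * ℓ + 4 ≤ 4 * k
      4ℓ+4≤4k = ≤-trans (≤-reflexive (trans (+-comm (4 * ℓ) 4) (sym (*-suc 4 ℓ)))) (*-monoʳ-≤ 4 ℓ<k)

      entry : ∀ i → i ≤ 3 → pile k (4 * ℓ + i) ≈ table (suc (k ∸ suc ℓ)) i
      entry i i≤3 = ≈-trans (pile≈W (4 * ℓ + i)) (≈-reflexive (trans (W-small 4ℓ+i<p) (table-block i ℓ<k)))
        where 4ℓ+i<p = <-≤-trans (+-monoʳ-< (4 * ℓ) (s≤s i≤3)) (≤-trans 4ℓ+4≤4k (m≤m+n (4 * k) 3))

  pile-last-block :
    (pile k (4 * k) ≡ᵍ *L) × (pile k (4 * k + 1) ≡ᵍ ⟪ *L , ⟪ *R ⟫ ⟫) × (pile k (4 * k + 2) ≡ᵍ ⟪ *L , *R ⟫)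
  pile-last-block =
    ≈⇒≡ᵍ (≈-trans (≈-reflexive (cong (pile k) (sym (+-identityʳ (4 * k))))) (entry 0 (s≤s z≤n)))
    ,′ ≈⇒≡ᵍ (entry 1 (s≤s (s≤s z≤n))) ,′ ≈⇒≡ᵍ (entry 2 ≤-refl)
    where
      entry : ∀ i → i < 3 → pile k (4 * k + i) ≈ table 0 i
      entry i i<3 = ≈-trans (pile≈W (4 * k + i)) (≈-reflexive (W-last i i<3))

corollary4p3 : ∀ (k : ℕ) → 1 ≤ k →
    (∀ (n : ℕ) → pile k (n + (4 * k + 3)) ≡ᵍ pile k n)
    × (∀ (ℓ : ℕ) → ℓ < k →
         (pile k (4 * ℓ) ≡ᵍ *L)
         × (pile k (4 * ℓ + 1) ≡ᵍ *R)
         × (pile k (4 * ℓ + 2) ≡ᵍ ⟪ *L ⟫)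
         × (pile k (4 * ℓ + 3) ≡ᵍ ⟪ *R ⟫))
    × (pile k (4 * k) ≡ᵍ *L)
    × (pile k (4 * k + 1) ≡ᵍ ⟪ *L , ⟪ *R ⟫ ⟫)
    × (pile k (4 * k + 2) ≡ᵍ ⟪ *L , *R ⟫)
corollary4p3 (suc j) _ = pile-periodic ,′ pile-block ,′ pile-last-block
  where open PeriodicSolution j
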